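{- Let $\models$ be any of the satisfaction relations $\models^{\mathrm{step}}$, $\models^{\mathrm{pobs}}$, $\models^{\mathrm{public}}$, $\models^{\mathrm{decr}}_Q$ or $\models^{\mathrm{incr}}_Q$ (for any $Q\subseteq P$) over a fixed SLTL structure. For every agent $a\in\mathit{Ag}$, every SLTL formula $\varphi$, all $f_1,f_2\in(2^P)^\omega$ and every $h\in(2^P)^+$ with $\mathit{last}(h)=\mathit{first}(f_1)=\mathit{first}(f_2)$, we have $(f_1,h)\models\langle a\rangle\varphi$ if and only if $(f_2,h)\models\langle a\rangle\varphi$.
   Context: Fix finite sets $P$ (atomic propositions) and $\mathit{Ag}$ (agents). For a finite or infinite word $\varsigma$ over $2^P$ and $R\subseteq P$, $\varsigma|_R$ is obtained by intersecting every letter with $R$; $\mathit{first}(\varsigma)$ and $\mathit{last}(\varsigma)$ are the first and last letters; for $f=H_0H_1\cdots$, $f[i]=H_i$, $f[i..j]=H_i\cdots H_j$ (the empty word if $i>j$), and $f[j..]=H_jH_{j+1}\cdots$. A transition system is $\mathcal T=(S,\to,\mathit{Init},R,L)$ with $S$ finite, $\to\subseteq S\times S$ total (every state has a successor), $\mathit{Init}\subseteq S$, $R$ a finite set of propositions and $L:S\to2^R$. For a path $\pi=s_0s_1\cdots$, $\mathit{trace}(\pi)=L(s_0)L(s_1)\cdots$; $\mathit{Traces}(\mathcal T,s)$ is the set of traces of infinite paths starting in $s$, $\mathit{Traces}(\mathcal T)$ the union over $s\in\mathit{Init}$; for $P\supseteq R$, $\mathit{Traces}^P(\mathcal T,s)=\{\rho\in(2^P)^\omega:\rho|_R\in\mathit{Traces}(\mathcal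 T,s)\}$; for $h\in(2^P)^+$, $\mathit{Reach}(\mathcal T,h)$ is the set of states $s$ such that some finite path starting in $\mathit{Init}$ ends in $s$ and has trace $h|_R$. SLTL formulas: $\varphi::=\mathit{true}\mid p\mid\neg\varphi\mid\varphi_1\wedge\varphi_2\mid\bigcirc\varphi\mid\varphi_1\,\mathrm U\,\varphi_2\mid\langle a\rangle\varphi$ with $p\in P$, $a\in\mathit{Ag}$. An SLTL structure is $\mathfrak T=(\mathcal T_0,(\mathcal T_a)_{a\in\mathit{Ag}})$ where $\mathcal T_0=(S_0,\to_0,\{\mathit{init}_0\},P,L_0)$ and $\mathcal T_a=(S_a,\to_a,\{\mathit{init}_a\},P_a,L_a)$ with $P_a\subseteq P$. Formulas are interpreted over future-history pairs $(f,h)\in(2^P)^\omega\times(2^P)^+$ with $\mathit{last}(h)=\mathit{first}(f)$: $(f,h)\models\mathit{true}$ always; $(f,h)\models p$ iff $p\in f[0]$; usual clauses for $\neg,\wedge$; $(f,h)\models\bigcirc\varphi$ iff $(f[1..],h\,f[1])\models\varphi$; $(f,h)\models\varphi_1\mathrm U\varphi_2$ iff there is $\ell\in\mathbb N$ with $(f[\ell..],h\,f[1..\ell])\models\varphi_2$ and $(f[j..],h\,f[1..j])\models\varphi_1$ for all $j<\ell$. Standpoint clause: $(f,h)\models\langle a\rangle\varphi$ iff there exist $h'\in(2^P)^+$, $t\in\mathit{Reach}(\mathcal T_a,h')$ and $f'\in\mathit{Traces}^P(\mathcal T_a,t)$ with $\mathit{last}(h')=\mathit{first}(f')$, $h|_{\mathfrak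 O}=h'|_{\mathfrak O}$ and $(f',h')\models'\varphi$, where: for the step semantics $\models^{\mathrm{step}}$, $\mathfrak O=\emptyset$ (i.e. $|h|=|h'|$) and $\models'=\models^{\mathrm{step}}$; for the pure observation-based semantics $\models^{\mathrm{pobs}}$, $\mathfrak O=P_a$, $\models'=\models^{\mathrm{pobs}}$; for the public-history semantics $\models^{\mathrm{public}}$, $\mathfrak O=P$, $\models'=\models^{\mathrm{public}}$; for the decremental semantics $\models^{\mathrm{decr}}_Q$ ($Q\subseteq P$), $\mathfrak O=Q\cap P_a$ and $\models'=\models^{\mathrm{decr}}_{Q\cap P_a}$; for the incremental semantics $\models^{\mathrm{incr}}_Q$, $\mathfrak O=Q\cup P_a$ and $\models'=\models^{\mathrm{incr}}_{Q\cup P_a}$ (in all other clauses the parameter $Q$ is unchanged). -}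

module Defs where

open import Data.Nat using (ℕ; zero; suc; _+_)
open import Data.Fin using (Fin)
open import Data.Fin.Subset using (Subset; _∩_; _∪_; _⊆_)
open import Data.List using (List; []; _∷_; upTo)
import Data.List as List
import Data.Fin.Subset
import Data.Nat
open import Data.List.NonEmpty using (List⁺; _∷_; _⁺++_; last; head)
import Data.List.NonEmpty as List⁺
open import Data.Product using (Σ; ∃; _×_; _,_)
open import Data.Unit using () renaming (⊤ to Unit)
open import Data.Empty using () renaming (⊥ to Empty)
open import Relation.Nullary using (¬_)
open import Relation.Binary.PropositionalEquality using (_≡_)

-- Propositions P = Fin nP; letters are elements of 2^P = Subset nP.
Letter : ℕ → Set
Letter nP = Subset nP

Word : ℕ → Set
Word nP = ℕ → Letter nP

History : ℕ → Set
History nP = List⁺ (Letter nP)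

restrict : ∀ {nP} → Subset nP → Letter nP → Letter nP
restrict R x = R ∩ x

restrictH : ∀ {nP} → Subset nP → History nP → History nP
restrictH R h = List⁺.map (restrict R) h

suffix : ∀ {nP} → Word nP → ℕ → Word nP
suffix f j = λ i → f (j + i)

-- f[1..ℓ]  (empty if ℓ = 0)
segment1 : ∀ {nP} → Word nP → ℕ → List (Letter nP)
segment1 f ℓ = List.map (λ i → f (suc i)) (upTo ℓ)

-- Transition system over propositions R ⊆ P with a single initial state
-- (as used for the components of an SLTL structure).  Labels are subsets
-- of P contained in R, i.e. elements of 2^R.
record TS (nP : ℕ) (R : Subset nP) : Set₁ where
  field
    nS    : ℕ
    _⟶_   : Fin nS → Fin nS → Set
    total : ∀ s → ∃ λ t → s ⟶ t
    init  : Fin nS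
    L     : Fin nS → Letter nP
    L⊆R   : ∀ s → L s ⊆ R

module _ {nP : ℕ} {R : Subset nP} (T : TS nP R) where
  open TS T

  Linked : Fin nS → List (Fin nS) → Set
  Linked s []       = Unit
  Linked s (t ∷ ts) = (s ⟶ t) × Linked t ts

  Reach : History nP → Fin nS → Set
  Reach h s = Σ (List⁺ (Fin nS)) λ π →
      (head π ≡ init) × Linked (head π) (List⁺.tail π) × (last π ≡ s)
    × (List⁺.map L π ≡ restrictH R h)

  TracesP : Fin nS → Word nP → Set
  TracesP t ρ = Σ (ℕ → Fin nS) λ π →
      (π 0 ≡ t) × (∀ i → π i ⟶ π (suc i)) × (∀ i → restrict R (ρ i) ≡ L (π i))

data Formula (nP nAg : ℕ) : Set where
  true  : Formula nP nAg
  prop  : Fin nP → Formula nP nAg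
  ¬'_   : Formula nP nAg → Formula nP nAg
  _∧'_  : Formula nP nAg → Formula nP nAg → Formula nP nAg
  ○_    : Formula nP nAg → Formula nP nAg
  _U_   : Formula nP nAg → Formula nP nAg → Formula nP nAg
  ⟨_⟩_  : Fin nAg → Formula nP nAg → Formula nP nAg

record Structure (nP nAg : ℕ) : Set₁ where
  field
    T₀ : TS nP Data.Fin.Subset.⊤
    Pa : Fin nAg → Subset nP
    Ta : (a : Fin nAg) → TS nP (Pa a)

data Mode (nP : ℕ) : Set where
  step pobs publ : Mode nP
  decr incr        : Subset nP → Mode nP

obs : ∀ {nP} → Mode nP → Subset nP → Subset nP
obs step       Pa = Data.Fin.Subset.⊥
obs pobs       Pa = Pa
obs publ     Pa = Data.Fin.Subset.⊤
obs (decr Q)   Pa = Q ∩ Pa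
obs (incr Q)   Pa = Q ∪ Pa

next : ∀ {nP} → Mode nP → Subset nP → Mode nP
next step     Pa = step
next pobs     Pa = pobs
next publ   Pa = publ
next (decr Q) Pa = decr (Q ∩ Pa)
next (incr Q) Pa = incr (Q ∪ Pa)

module Semantics {nP nAg : ℕ} (𝔗 : Structure nP nAg) where
  open Structure 𝔗

  sat : Mode nP → Formula nP nAg → Word nP → History nP → Set
  sat m true      f h = Unit
  sat m (prop p)  f h = p Data.Fin.Subset.∈ f 0
  sat m (¬' φ)    f h = ¬ sat m φ f h
  sat m (φ ∧' ψ)  f h = sat m φ f h × sat m ψ f h
  sat m (○ φ)     f h = sat m φ (suffix f 1) (h ⁺++ (f 1 ∷ []))
  sat m (φ U ψ)   f h = Σ ℕ λ ℓ →
      sat m ψ (suffix f ℓ) (h ⁺++ segment1 f ℓ)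
    × (∀ j → j Data.Nat.< ℓ → sat m φ (suffix f j) (h ⁺++ segment1 f j))
  sat m (⟨ a ⟩ φ) f h = Σ (History nP) λ h' → Σ (Fin (TS.nS (Ta a))) λ t →
      Σ (Word nP) λ f' →
      Reach (Ta a) h' t × TracesP (Ta a) t f' × (last h' ≡ f' 0)
    × (restrictH (obs m (Pa a)) h ≡ restrictH (obs m (Pa a)) h')
    × sat (next m (Pa a)) φ f' h'

{-# OPTIONS --safe #-}
module Submission where

open import Defs
open import Data.Nat using (ℕ)
open import Data.Fin using (Fin)
open import Data.List.NonEmpty using (last)
open import Function.Bundles using (_⇔_)
open import Function.Construct.Identity using (⇔-id)
open import Relation.Binary.PropositionalEquality using (_≡_)

-- The clause for ⟨ a ⟩ φ at (f , h) quantifies over a fresh future f' and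
-- relates it to the actual pair only through h, so both sides are the same
-- type.
lemma3p2 : {nP nAg : ℕ} (𝔗 : Structure nP nAg) (m : Mode nP)
    (a : Fin nAg) (φ : Formula nP nAg) (f₁ f₂ : Word nP) (h : History nP) →
    last h ≡ f₁ 0 → last h ≡ f₂ 0 →
    Semantics.sat 𝔗 m (⟨ a ⟩ φ) f₁ h ⇔ Semantics.sat 𝔗 m (⟨ a ⟩ φ) f₂ h
lemma3p2 𝔗 m a φ f₁ f₂ h _ _ = ⇔-id (Semantics.sat 𝔗 m (⟨ a ⟩ φ) f₁ h)
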